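{- For every $\pi\in PM_{2n}$, $$\ell(\pi)=\mathrm{cr}(\pi)+2\,\mathrm{ne}(\pi)\qquad\text{and}\qquad \mathrm{t}(\pi)=n^2+\binom{n}{2}-2\,\mathrm{cr}(\pi)-\mathrm{ne}(\pi).$$
   Context: A perfect matching on $[2n]$ is a set partition of $[2n]$ into blocks of size $2$; $PM_{2n}$ is the set of them. A block $\{i<j\}$ is an arc $(i,j)$, with span $\mathrm{span}(i,j)=j-i-1$. For two arcs $(i,j)$, $(k,l)$ with $i<k$, the pair is a crossing if $i<k<j<l$ and a nesting if $i<k<l<j$; $\mathrm{cr}(\pi)$ and $\mathrm{ne}(\pi)$ are the numbers of crossings and nestings. The function $\ell$ (the rank function of the Bruhat order on fixed-point-free involutions of $S_{2n}$, identified with perfect matchings) is $\ell(\pi)=\sum_{\alpha\in\mathrm{Arcs}(\pi)}\mathrm{span}(\alpha)-\mathrm{cr}(\pi)$. For a vertex $v$, $\mathrm{depth}(v)$ is the number of arcs $(i,j)$ with $i<v<j$; for an arc $\alpha=(u,v)$, $\mathrm{depth}(\alpha)$ is the number of arcs $(i,j)$ with $i<u<v<j$. The depth index is $\mathrm{t}(\pi)=\sum_{i=1}^{n}(2n-i)-\sum_{v=1}^{2n}\mathrm{depth}(v)+\sum_{\alpha\in\mathrm{Arcs}(\pi)}\mathrm{depth}(\alpha)$. -}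

module Defs where

open import Data.Nat using (ℕ; zero; suc; _+_; _*_; _∸_)
open import Data.Fin using (Fin; toℕ; _<?_)
open import Data.Fin.Properties using (_≟_)
open import Data.List using (List; map; allFin; upTo)
open import Data.Nat.ListAction using (sum)
open import Data.Bool using (Bool; true; false; if_then_else_; _∧_)
open import Relation.Nullary using (¬_)
open import Relation.Nullary.Decidable using (⌊_⌋)
open import Relation.Binary.PropositionalEquality using (_≡_)
open import Data.Integer as ℤ using (ℤ; +_)

-- Vertices [2n] are represented 0-indexed by Fin (2 * n) (spans, depths,
-- crossings and nestings are invariant under this shift).
record PerfectMatching (n : ℕ) : Set where
  field
    partner     : Fin (2 * n) → Fin (2 * n)
    involutive  : ∀ i → partner (partner i) ≡ i
    fixedPtFree : ∀ i → ¬ (partner i ≡ i)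
open PerfectMatching public

sumFin : ∀ {m} → (Fin m → ℕ) → ℕ
sumFin {m} f = sum (map f (allFin m))

[_] : Bool → ℕ
[ b ] = if b then 1 else 0

module _ {n : ℕ} (π : PerfectMatching n) where
  private
    σ = partner π
    lt : Fin (2 * n) → Fin (2 * n) → Bool
    lt a b = ⌊ a <? b ⌋

  isOpener : Fin (2 * n) → Bool
  isOpener i = lt i (σ i)

  cr : ℕ
  cr = sumFin λ i → sumFin λ k →
         [ isOpener i ∧ isOpener k ∧ lt i k ∧ lt k (σ i) ∧ lt (σ i) (σ k) ]

  ne : ℕ
  ne = sumFin λ i → sumFin λ k →
         [ isOpener i ∧ isOpener k ∧ lt i k ∧ lt (σ k) (σ i) ]

  spanSum : ℕ
  spanSum = sumFin λ i → if isOpener i then toℕ (σ i) ∸ toℕ i ∸ 1 else 0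

  ℓ : ℤ
  ℓ = + spanSum ℤ.- + cr

  depthV : Fin (2 * n) → ℕ
  depthV v = sumFin λ i → [ isOpener i ∧ lt i v ∧ lt v (σ i) ]

  depthA : Fin (2 * n) → ℕ
  depthA u = sumFin λ i → [ isOpener i ∧ lt i u ∧ lt (σ u) (σ i) ]

  baseSum : ℕ
  baseSum = sum (map (λ i → 2 * n ∸ suc i) (upTo n))

  t : ℤ
  t = + baseSum ℤ.- + (sumFin depthV)
        ℤ.+ + (sumFin λ u → if isOpener u then depthA u else 0)

{-# OPTIONS --safe #-}
-- A vertex strictly under an arc α is an endpoint of another arc β, so
-- Σ span(α) = Σ depth(v) counts, over ordered pairs of arcs (α, β), the
-- endpoints of β under α: one if α and β cross, two if β is nested in α.
-- Thus Σ span(α) = Σ depth(v) = 2 cr + 2 ne, while Σ depth(α) = ne and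
-- Σ_{i=1}^{n} (2n − i) = n² + C(n, 2).
module Submission where

open import Defs
open import Data.Nat.Combinatorics using (_C_)
open import Data.Product using (_×_; _,_)
open import Relation.Binary.PropositionalEquality
  using (_≡_; _≢_; refl; sym; trans; cong; cong₂; subst; module ≡-Reasoning)
open import Data.Nat using (ℕ)
import Data.Nat as ℕ
open import Data.Bool using (if_then_else_)

-- A separate module, so that ℕ's _+_ and _*_ do not clash with ℤ's below.
module Counting where
  open import Data.Nat
    using (ℕ; zero; suc; _+_; _*_; _∸_; _⊓_; _<_; _<?_)
  open import Data.Nat.Properties
    using ( +-0-commutativeMonoid; +-comm; +-identityʳ; +-∸-assoc; ∸-+-assoc
          ; m≤n⇒m∸n≡0; m≤n⇒m⊓n≡m; m≥n⇒m⊓n≡n; m≤n⇒m≤1+n; <⇒≤; ≮⇒≥; <⇒≯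
          ; <-cmp; <-irrefl; <-trans; <⇒≢ )
  open import Data.Nat.Combinatorics using (nC1≡n; nCk+nC[k+1]≡[n+1]C[k+1])
  open import Data.Nat.Tactic.RingSolver using (solve-∀)
  open import Data.Nat.ListAction using () renaming (sum to sumList)
  open import Data.Bool using (Bool; true; false; T; not; _∧_; if_then_else_)
  open import Data.Bool.Properties using (∧-zeroʳ; ∧-identityʳ; if-not)
  open import Data.Fin using (Fin; toℕ; inject₁; fromℕ)
  open import Data.Fin.Properties using (toℕ-inject₁; toℕ-fromℕ; toℕ<n; toℕ-injective)
  import Data.Fin.Permutation as Perm
  open import Data.List using (map; tabulate; applyUpTo; upTo)
  open import Data.List.Properties using (map-tabulate; map-upTo)
  open import Algebra.Properties.CommutativeMonoid.Sum +-0-commutativeMonoid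
    using (sum; ∑-comm; ∑-distrib-+; ∑-permute; sum-cong-≗; sum-init-last; sum-replicate-zero)
  open import Relation.Binary.Definitions using (tri<; tri≈; tri>)
  open import Relation.Nullary using (¬_; yes; no; contradiction)
  open import Relation.Nullary.Decidable using (⌊_⌋; toWitness; isYes≗does; dec-true; dec-false)
  open import Function using (id; _∘_)
  open import Data.Unit using (tt)
  open ≡-Reasoning

  ⌊<?⌋≡true : ∀ {m n} → m < n → ⌊ m <? n ⌋ ≡ true
  ⌊<?⌋≡true m<n = trans (isYes≗does (_ <? _)) (dec-true (_ <? _) m<n)

  ⌊<?⌋≡false : ∀ {m n} → ¬ m < n → ⌊ m <? n ⌋ ≡ false
  ⌊<?⌋≡false m≮n = trans (isYes≗does (_ <? _)) (dec-false (_ <? _) m≮n)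

  ⌊<?⌋≡true⇒< : ∀ {m n} → ⌊ m <? n ⌋ ≡ true → m < n
  ⌊<?⌋≡true⇒< m<?n = toWitness (subst T (sym m<?n) tt)

  ⌊<?⌋-flip : ∀ {m n} → m ≢ n → ⌊ n <? m ⌋ ≡ not ⌊ m <? n ⌋
  ⌊<?⌋-flip {m} {n} m≢n with <-cmp m n
  ... | tri< m<n _ _ rewrite ⌊<?⌋≡true m<n | ⌊<?⌋≡false (<⇒≯ m<n) = refl
  ... | tri≈ _ m≡n _ = contradiction m≡n m≢n
  ... | tri> _ _ n<m rewrite ⌊<?⌋≡true n<m | ⌊<?⌋≡false (<⇒≯ n<m) = refl

  sumList-tabulate : ∀ {m} (f : Fin m → ℕ) → sumList (tabulate f) ≡ sum f
  sumList-tabulate {zero}  f = refl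
  sumList-tabulate {suc m} f = cong (f Fin.zero +_) (sumList-tabulate (f ∘ Fin.suc))

  sumFin≡sum : ∀ {m} (f : Fin m → ℕ) → sumFin f ≡ sum f
  sumFin≡sum f = trans (cong sumList (map-tabulate id f)) (sumList-tabulate f)

  sumFin²≡sum² : ∀ {m k} (f : Fin m → Fin k → ℕ) →
                 sumFin (λ i → sumFin (f i)) ≡ sum (λ i → sum (f i))
  sumFin²≡sum² f = trans (sumFin≡sum (λ i → sumFin (f i))) (sum-cong-≗ (λ i → sumFin≡sum (f i)))

  if-split : ∀ b (x : ℕ) → x ≡ (if b then x else 0) + (if b then 0 else x)
  if-split true  x = sym (+-identityʳ x)
  if-split false x = refl

  if-+ : ∀ b (x y : ℕ) →
         (if b then x else 0) + (if b then y else 0) ≡ (if b then x + y else 0)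
  if-+ true  x y = refl
  if-+ false x y = refl

  count-between-step : ∀ m a b →
    m ⊓ b ∸ suc a + [ ⌊ a <? m ⌋ ∧ ⌊ m <? b ⌋ ] ≡ suc m ⊓ b ∸ suc a
  count-between-step m a b with m <? b
  ... | no m≮b
    rewrite ⌊<?⌋≡false m≮b | ∧-zeroʳ ⌊ a <? m ⌋
          | m≥n⇒m⊓n≡n (≮⇒≥ m≮b) | m≥n⇒m⊓n≡n (m≤n⇒m≤1+n (≮⇒≥ m≮b))
    = +-identityʳ _
  ... | yes m<b
    rewrite ⌊<?⌋≡true m<b | ∧-identityʳ ⌊ a <? m ⌋
          | m≤n⇒m⊓n≡m (<⇒≤ m<b) | m≤n⇒m⊓n≡m m<b
    with a <? m
  ...   | yes a<m rewrite ⌊<?⌋≡true a<m = trans (+-comm _ 1) (sym (+-∸-assoc 1 a<m))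
  ...   | no a≮m rewrite ⌊<?⌋≡false a≮m =
          trans (+-identityʳ _)
                (trans (m≤n⇒m∸n≡0 (m≤n⇒m≤1+n (≮⇒≥ a≮m))) (sym (m≤n⇒m∸n≡0 (≮⇒≥ a≮m))))

  count-between : ∀ m a b →
    sum {m} (λ v → [ ⌊ a <? toℕ v ⌋ ∧ ⌊ toℕ v <? b ⌋ ]) ≡ m ⊓ b ∸ suc a
  count-between zero    a b = refl
  count-between (suc m) a b = begin
      sum {suc m} (between ∘ toℕ)
    ≡⟨ sum-init-last {m} (between ∘ toℕ) ⟩
      sum {m} (between ∘ toℕ ∘ inject₁) + between (toℕ (fromℕ m))
    ≡⟨ cong₂ _+_ (sum-cong-≗ {m} (cong between ∘ toℕ-inject₁)) (cong between (toℕ-fromℕ m)) ⟩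
      sum {m} (between ∘ toℕ) + between m
    ≡⟨ cong (_+ between m) (count-between m a b) ⟩
      m ⊓ b ∸ suc a + between m
    ≡⟨ count-between-step m a b ⟩
      suc m ⊓ b ∸ suc a ∎
    where
    between : ℕ → ℕ
    between v = [ ⌊ a <? v ⌋ ∧ ⌊ v <? b ⌋ ]

  count-between-Fin : ∀ {m} (a b : Fin m) →
    sum {m} (λ v → [ ⌊ toℕ a <? toℕ v ⌋ ∧ ⌊ toℕ v <? toℕ b ⌋ ]) ≡ toℕ b ∸ toℕ a ∸ 1
  count-between-Fin {m} a b = begin
      sum {m} (λ v → [ ⌊ toℕ a <? toℕ v ⌋ ∧ ⌊ toℕ v <? toℕ b ⌋ ])
    ≡⟨ count-between m (toℕ a) (toℕ b) ⟩
      m ⊓ toℕ b ∸ suc (toℕ a)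
    ≡⟨ cong (_∸ suc (toℕ a)) (m≥n⇒m⊓n≡n (<⇒≤ (toℕ<n b))) ⟩
      toℕ b ∸ suc (toℕ a)
    ≡⟨ cong (toℕ b ∸_) (+-comm 1 (toℕ a)) ⟩
      toℕ b ∸ (toℕ a + 1)
    ≡⟨ sym (∸-+-assoc (toℕ b) (toℕ a) 1) ⟩
      toℕ b ∸ toℕ a ∸ 1 ∎

  [1+m]C2≡m+mC2 : ∀ m → suc m C 2 ≡ m + m C 2
  [1+m]C2≡m+mC2 m = begin
    suc m C 2          ≡⟨ nCk+nC[k+1]≡[n+1]C[k+1] m 1 ⟨
    m C 1 + m C 2      ≡⟨ cong (_+ m C 2) (nC1≡n m) ⟩
    m + m C 2          ∎

  sum-consecutive : ∀ m k → sumList (applyUpTo (λ i → m + k ∸ suc i) m) ≡ m * k + m C 2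
  sum-consecutive zero    k = refl
  sum-consecutive (suc m) k = begin
      m + k + sumList (applyUpTo (λ i → m + k ∸ suc i) m)
    ≡⟨ cong (m + k +_) (sum-consecutive m k) ⟩
      m + k + (m * k + m C 2)
    ≡⟨ regroup m k (m C 2) ⟩
      k + m * k + (m + m C 2)
    ≡⟨ cong (k + m * k +_) ([1+m]C2≡m+mC2 m) ⟨
      suc m * k + suc m C 2 ∎
    where
    regroup : ∀ m k c → m + k + (m * k + c) ≡ k + m * k + (m + c)
    regroup = solve-∀

  baseSum≡n*n+nC2 : ∀ {n} (π : PerfectMatching n) → baseSum π ≡ n * n + n C 2
  baseSum≡n*n+nC2 {n} π = begin
      sumList (map (λ i → 2 * n ∸ suc i) (upTo n))
    ≡⟨ cong sumList (map-upTo _ n) ⟩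
      sumList (applyUpTo (λ i → n + (n + 0) ∸ suc i) n)
    ≡⟨ cong (λ k → sumList (applyUpTo (λ i → n + k ∸ suc i) n)) (+-identityʳ n) ⟩
      sumList (applyUpTo (λ i → n + n ∸ suc i) n)
    ≡⟨ sum-consecutive n n ⟩
      n * n + n C 2 ∎

  -- (a, b) and (c, d) are arcs of a matching: they share both endpoints or neither.
  endpointsInside≡crossings+2nestings : ∀ {a b c d} →
      c < d → (a ≡ c → b ≡ d) → (b ≡ d → a ≡ c) →
      [ ⌊ a <? c ⌋ ∧ ⌊ c <? b ⌋ ] + [ ⌊ a <? d ⌋ ∧ ⌊ d <? b ⌋ ]
    ≡ [ ⌊ a <? c ⌋ ∧ ⌊ c <? b ⌋ ∧ ⌊ b <? d ⌋ ] + [ ⌊ c <? a ⌋ ∧ ⌊ a <? d ⌋ ∧ ⌊ d <? b ⌋ ]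
      + ([ ⌊ a <? c ⌋ ∧ ⌊ d <? b ⌋ ] + [ ⌊ a <? c ⌋ ∧ ⌊ d <? b ⌋ ])
  endpointsInside≡crossings+2nestings {a} {b} {c} {d} c<d a≡c⇒b≡d b≡d⇒a≡c with <-cmp a c
  ... | tri≈ _ a≡c _
    rewrite ⌊<?⌋≡false (<-irrefl a≡c) | ⌊<?⌋≡false (<-irrefl (sym a≡c))
          | ⌊<?⌋≡false (<-irrefl (sym (a≡c⇒b≡d a≡c))) | ∧-zeroʳ ⌊ a <? d ⌋
    = refl
  ... | tri> _ _ c<a rewrite ⌊<?⌋≡false (<⇒≯ c<a) | ⌊<?⌋≡true c<a = sym (+-identityʳ _)
  ... | tri< a<c _ _
    rewrite ⌊<?⌋≡true a<c | ⌊<?⌋≡false (<⇒≯ a<c) | ⌊<?⌋≡true (<-trans a<c c<d)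
    with <-cmp b d
  ...   | tri< b<d _ _
    rewrite ⌊<?⌋≡true b<d | ⌊<?⌋≡false (<⇒≯ b<d) | ∧-identityʳ ⌊ c <? b ⌋
    = sym (+-identityʳ _)
  ...   | tri≈ _ b≡d _ = contradiction (b≡d⇒a≡c b≡d) (<⇒≢ a<c)
  ...   | tri> _ _ d<b
    rewrite ⌊<?⌋≡true (<-trans c<d d<b) | ⌊<?⌋≡false (<⇒≯ d<b) | ⌊<?⌋≡true d<b
    = refl

  module _ {n : ℕ} (π : PerfectMatching n) where
    private
      σ : Fin (2 * n) → Fin (2 * n)
      σ = partner π

      σ-permutation : Perm.Permutation′ (2 * n)
      σ-permutation = Perm.permutation σ σ (involutive π) (involutive π)

      opener : Fin (2 * n) → Bool
      opener = isOpener π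

      under : Fin (2 * n) → Fin (2 * n) → ℕ
      under i v = [ opener i ∧ ⌊ toℕ i <? toℕ v ⌋ ∧ ⌊ toℕ v <? toℕ (σ i) ⌋ ]

      crossing nesting : Fin (2 * n) → Fin (2 * n) → ℕ
      crossing i k = [ opener i ∧ opener k ∧ ⌊ toℕ i <? toℕ k ⌋ ∧ ⌊ toℕ k <? toℕ (σ i) ⌋
                                            ∧ ⌊ toℕ (σ i) <? toℕ (σ k) ⌋ ]
      nesting  i k = [ opener i ∧ opener k ∧ ⌊ toℕ i <? toℕ k ⌋ ∧ ⌊ toℕ (σ k) <? toℕ (σ i) ⌋ ]

    isOpener-partner : ∀ k → isOpener π (partner π k) ≡ not (isOpener π k)
    isOpener-partner k =
      trans (cong (λ j → ⌊ toℕ (σ k) <? toℕ j ⌋) {σ (σ k)} (involutive π k))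
            (⌊<?⌋-flip (fixedPtFree π k ∘ sym ∘ toℕ-injective))

    ∑-vertices≡∑-arcs : (f : Fin (2 * n) → ℕ) →
      sum f ≡ sum (λ k → if isOpener π k then f k + f (partner π k) else 0)
    ∑-vertices≡∑-arcs f = begin
        sum f
      ≡⟨ sum-cong-≗ (λ v → if-split (opener v) (f v)) ⟩
        sum (λ v → atOpener v + atCloser v)
      ≡⟨ ∑-distrib-+ atOpener atCloser ⟩
        sum atOpener + sum atCloser
      ≡⟨ cong (sum atOpener +_) (∑-permute atCloser σ-permutation) ⟩
        sum atOpener + sum (atCloser ∘ σ)
      ≡⟨ cong (sum atOpener +_) (sum-cong-≗ atCloser∘σ≗atOpener∘σ) ⟩
        sum atOpener + sum (λ k → if opener k then f (σ k) else 0)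
      ≡⟨ ∑-distrib-+ atOpener _ ⟨
        sum (λ k → atOpener k + (if opener k then f (σ k) else 0))
      ≡⟨ sum-cong-≗ (λ k → if-+ (opener k) (f k) (f (σ k))) ⟩
        sum (λ k → if opener k then f k + f (σ k) else 0) ∎
      where
      atOpener atCloser : Fin (2 * n) → ℕ
      atOpener v = if opener v then f v else 0
      atCloser v = if opener v then 0 else f v

      atCloser∘σ≗atOpener∘σ : ∀ k → atCloser (σ k) ≡ (if opener k then f (σ k) else 0)
      atCloser∘σ≗atOpener∘σ k =
        trans (cong (λ b → if b then 0 else f (σ k)) (isOpener-partner k)) (if-not (opener k))

    spanSum≡∑depthV : spanSum π ≡ sumFin (depthV π)
    spanSum≡∑depthV = begin
        spanSum π
      ≡⟨ sumFin≡sum arcSpan ⟩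
        sum arcSpan
      ≡⟨ sum-cong-≗ arcSpan≡count ⟩
        sum (λ i → sum (under i))
      ≡⟨ ∑-comm under ⟩
        sum (λ v → sum (λ i → under i v))
      ≡⟨ sumFin²≡sum² (λ v i → under i v) ⟨
        sumFin (depthV π) ∎
      where
      arcSpan : Fin (2 * n) → ℕ
      arcSpan i = if opener i then toℕ (σ i) ∸ toℕ i ∸ 1 else 0

      arcSpan≡count : ∀ i → arcSpan i ≡ sum (under i)
      arcSpan≡count i with opener i
      ... | true  = sym (count-between-Fin i (σ i))
      ... | false = sym (sum-replicate-zero (2 * n))

    under-arc≡crossings+2nestings : ∀ i k →
      (if opener k then under i k + under i (σ k) else 0)
      ≡ crossing i k + crossing k i + (nesting i k + nesting i k)
    under-arc≡crossings+2nestings i k with opener i | opener k in opener-k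
    ... | true  | true  =
      endpointsInside≡crossings+2nestings (⌊<?⌋≡true⇒< opener-k)
        (cong (toℕ ∘ σ) ∘ toℕ-injective) partner-injective
      where
      partner-injective : toℕ (σ i) ≡ toℕ (σ k) → toℕ i ≡ toℕ k
      partner-injective e = cong toℕ (begin
        i         ≡⟨ involutive π i ⟨
        σ (σ i)   ≡⟨ cong σ (toℕ-injective e) ⟩
        σ (σ k)   ≡⟨ involutive π k ⟩
        k         ∎)
    ... | true  | false = refl
    ... | false | true  = refl
    ... | false | false = refl

    ∑depthV≡2cr+2ne : sumFin (depthV π) ≡ cr π + cr π + (ne π + ne π)
    ∑depthV≡2cr+2ne = begin
        sumFin (depthV π)
      ≡⟨ sumFin²≡sum² (λ v i → under i v) ⟩
        sum (λ v → sum (λ i → under i v))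
      ≡⟨ ∑-comm (λ v i → under i v) ⟩
        sum (λ i → sum (under i))
      ≡⟨ sum-cong-≗ (λ i → ∑-vertices≡∑-arcs (under i)) ⟩
        sum (λ i → sum (λ k → if opener k then under i k + under i (σ k) else 0))
      ≡⟨ sum-cong-≗ (λ i → sum-cong-≗ (under-arc≡crossings+2nestings i)) ⟩
        sum (λ i → sum (λ k → crossing i k + crossing k i + (nesting i k + nesting i k)))
      ≡⟨ sum-cong-≗ (λ i → ∑-distrib-+₄ (crossing i) (λ k → crossing k i) (nesting i)) ⟩
        sum (λ i → sum (crossing i) + sum (λ k → crossing k i) + (sum (nesting i) + sum (nesting i)))
      ≡⟨ ∑-distrib-+₄ (λ i → sum (crossing i)) (λ i → sum (λ k → crossing k i)) (λ i → sum (nesting i)) ⟩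
        C + sum (λ i → sum (λ k → crossing k i)) + (N + N)
      ≡⟨ cong (λ x → C + x + (N + N)) (∑-comm (λ i k → crossing k i)) ⟩
        C + C + (N + N)
      ≡⟨ cong₂ (λ x y → x + x + (y + y)) (sumFin²≡sum² crossing) (sumFin²≡sum² nesting) ⟨
        cr π + cr π + (ne π + ne π) ∎
      where
      C N : ℕ
      C = sum (λ i → sum (crossing i))
      N = sum (λ i → sum (nesting i))

      ∑-distrib-+₄ : (f g h : Fin (2 * n) → ℕ) →
        sum (λ x → f x + g x + (h x + h x)) ≡ sum f + sum g + (sum h + sum h)
      ∑-distrib-+₄ f g h =
        trans (∑-distrib-+ (λ x → f x + g x) (λ x → h x + h x))
              (cong₂ _+_ (∑-distrib-+ f g) (∑-distrib-+ h h))

    ∑depthA≡ne : sumFin (λ u → if isOpener π u then depthA π u else 0) ≡ ne π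
    ∑depthA≡ne = begin
        sumFin arcDepth
      ≡⟨ sumFin≡sum arcDepth ⟩
        sum arcDepth
      ≡⟨ sum-cong-≗ arcDepth≡∑nesting ⟩
        sum (λ u → sum (λ i → nesting i u))
      ≡⟨ ∑-comm (λ u i → nesting i u) ⟩
        sum (λ i → sum (nesting i))
      ≡⟨ sumFin²≡sum² nesting ⟨
        ne π ∎
      where
      arcDepth : Fin (2 * n) → ℕ
      arcDepth u = if opener u then depthA π u else 0

      arcDepth≡∑nesting : ∀ u → arcDepth u ≡ sum (λ i → nesting i u)
      arcDepth≡∑nesting u with opener u
      ... | true  = sumFin≡sum (λ i → [ opener i ∧ ⌊ toℕ i <? toℕ u ⌋ ∧ ⌊ toℕ (σ u) <? toℕ (σ i) ⌋ ])
      ... | false = sym (trans (sum-cong-≗ (λ i → cong [_] (∧-zeroʳ (opener i))))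
                               (sum-replicate-zero (2 * n)))

open Counting using (spanSum≡∑depthV; ∑depthV≡2cr+2ne; ∑depthA≡ne; baseSum≡n*n+nC2)

open import Data.Integer using (ℤ; +_; _+_; _-_; _*_)
open import Data.Integer.Properties using (pos-+; pos-*)
open import Data.Integer.Tactic.RingSolver using (solve-∀)

pos-[c+c]+[e+e] : ∀ c e → + (c ℕ.+ c ℕ.+ (e ℕ.+ e)) ≡ + c + + c + (+ e + + e)
pos-[c+c]+[e+e] c e = trans (pos-+ (c ℕ.+ c) (e ℕ.+ e)) (cong₂ _+_ (pos-+ c c) (pos-+ e e))

pos-[m*m]+k : ∀ m k → + (m ℕ.* m ℕ.+ k) ≡ + m * + m + + k
pos-[m*m]+k m k = trans (pos-+ (m ℕ.* m) k) (cong (_+ + k) (pos-* m m))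

ℓ-arith : ∀ (c e : ℤ) → c + c + (e + e) - c ≡ c + + 2 * e
ℓ-arith = solve-∀

t-arith : ∀ (m k c e : ℤ) → m * m + k - (c + c + (e + e)) + e ≡ m * m + k - + 2 * c - e
t-arith = solve-∀

mainTheorem5 : (n : ℕ) (π : PerfectMatching n) →
    (ℓ π ≡ + cr π + + 2 * + ne π)
    × (t π ≡ + n * + n + + (n C 2) - + 2 * + cr π - + ne π)
mainTheorem5 n π = ℓ-formula , t-formula
  where
  open ≡-Reasoning

  depthSum : + sumFin (depthV π) ≡ + cr π + + cr π + (+ ne π + + ne π)
  depthSum = trans (cong +_ (∑depthV≡2cr+2ne π)) (pos-[c+c]+[e+e] (cr π) (ne π))

  ℓ-formula : ℓ π ≡ + cr π + + 2 * + ne π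
  ℓ-formula = begin
      + spanSum π - + cr π
    ≡⟨ cong (λ s → + s - + cr π) (spanSum≡∑depthV π) ⟩
      + sumFin (depthV π) - + cr π
    ≡⟨ cong (_- + cr π) depthSum ⟩
      + cr π + + cr π + (+ ne π + + ne π) - + cr π
    ≡⟨ ℓ-arith (+ cr π) (+ ne π) ⟩
      + cr π + + 2 * + ne π ∎

  t-formula : t π ≡ + n * + n + + (n C 2) - + 2 * + cr π - + ne π
  t-formula = begin
      + baseSum π - + sumFin (depthV π) + + sumFin (λ u → if isOpener π u then depthA π u else 0)
    ≡⟨ cong₂ (λ b a → + b - + sumFin (depthV π) + + a) (baseSum≡n*n+nC2 π) (∑depthA≡ne π) ⟩
      + (n ℕ.* n ℕ.+ n C 2) - + sumFin (depthV π) + + ne π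
    ≡⟨ cong₂ (λ b d → b - d + + ne π) (pos-[m*m]+k n (n C 2)) depthSum ⟩
      + n * + n + + (n C 2) - (+ cr π + + cr π + (+ ne π + + ne π)) + + ne π
    ≡⟨ t-arith (+ n) (+ (n C 2)) (+ cr π) (+ ne π) ⟩
      + n * + n + + (n C 2) - + 2 * + cr π - + ne π ∎
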